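{- Let $H_0$ be the graph with vertex set $\{u,x,v,w,u',u'',x',x'',w',w''\}$ and edge set $\{u'u,\ ux,\ xx',\ vw,\ ww'',\ u''u,\ uv,\ x''x,\ xw,\ ww'\}$. Let $L_0$ be a list assignment of $H_0$ with $|L_0(i,ij)|\ge6$ for every incidence $(i,ij)$ of $H_0$. Let $\sigma_0$ be a partial $L_0$-list incidence colouring of $H_0$ whose coloured incidences are exactly $(u',u'u)$, $(u,uu')$, $(u,uv)$, $(v,vu)$, $(w,wv)$, $(w,ww')$, $(w,ww'')$, $(w,wx)$, with respective colours $\alpha'_1,\alpha_1,\alpha_2,\alpha'_2,\beta_1,\beta_2,\beta_3,\beta_4$. Then there exist $a\in L_0(u,ux)\setminus\{\alpha_1,\alpha'_1,\alpha_2,\alpha'_2\}$, $b\in L_0(u,uu'')\setminus\{\alpha_1,\alpha'_1,\alpha_2,\alpha'_2\}$, $c\in L_0(x,xu)\setminus\{\alpha_1,\alpha_2,\beta_4\}$ and $d\in L_0(x,xw)\setminus\{\beta_1,\beta_2,\beta_3,\beta_4\}$ such that $|\{a,b,c\}|=|\{a,c,d\}|=3$; consequently $\sigma_0$ extended by $(u,ux)\mapsto a$, $(u,uu'')\mapsto b$, $(x,xu)\mapsto c$, $(x,xw)\mapsto d$ is a partial $L_0$-list incidence colouring of $H_0$.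
   Context: An incidence of a graph is a pair $(v,e)$ with $v$ a vertex and $e$ an edge incident with $v$, written $(v,vu)$ when $e=vu$. Two incidences $(v,e)$, $(w,f)$ are adjacent if $v=w$, or $e=f$, or the edge $vw$ equals $e$ or $f$. A list assignment $L$ assigns to each incidence a finite set of colours. A partial $L$-list incidence colouring is a map $\sigma$ defined on a subset of the incidences with $\sigma(v,e)\in L(v,e)$ and such that any two adjacent coloured incidences receive distinct colours. -}

module Defs where

open import Data.Nat using (ℕ; zero; suc; _≤_)
open import Data.Fin using (Fin; zero; suc)
open import Data.Bool using (Bool; true; false; T)
open import Data.Maybe using (Maybe; just; nothing)
open import Data.List using (List; length)
open import Data.List.Membership.Propositional using (_∈_)
open import Data.List.Relation.Unary.Unique.Propositional using (Unique)
open import Data.Product using (Σ; Σ-syntax; _×_; _,_)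
open import Data.Sum using (_⊎_)
open import Relation.Binary.PropositionalEquality using (_≡_; _≢_)

record Graph : Set₁ where
  field
    V   : Set
    Adj : V → V → Set   -- symmetric adjacency relation (vz is an edge)

module _ (G : Graph) where
  open Graph G

  -- the incidence (v , vz), i.e. vertex v together with the edge vz
  Incidence : Set
  Incidence = Σ[ v ∈ V ] Σ[ z ∈ V ] Adj v z

  SameEdge : V → V → V → V → Set
  SameEdge a b c d = (a ≡ c × b ≡ d) ⊎ (a ≡ d × b ≡ c)

  -- (v , e) and (w , f) adjacent: v = w, or e = f, or vw = e, or vw = f
  AdjacentInc : Incidence → Incidence → Set
  AdjacentInc (v , z , _) (w , y , _) =
    v ≡ w ⊎ SameEdge v z w y ⊎ SameEdge v w v z ⊎ SameEdge v w w y

  -- a list assignment: a finite set of colours (duplicate-free list) per incidence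
  ListAssignment : Set
  ListAssignment = Incidence → List ℕ

  IsListAssignment : ListAssignment → Set
  IsListAssignment L = (i : Incidence) → Unique (L i)

  PartialColouring : Set
  PartialColouring = Incidence → Maybe ℕ

  IsPartialListIncidenceColouring : ListAssignment → PartialColouring → Set
  IsPartialListIncidenceColouring L σ =
    ((i : Incidence) (c : ℕ) → σ i ≡ just c → c ∈ L i) ×
    ((i j : Incidence) (c c' : ℕ) → i ≢ j → AdjacentInc i j →
       σ i ≡ just c → σ j ≡ just c' → c ≢ c')

pattern u   = zero
pattern x   = suc zero
pattern v   = suc (suc zero)
pattern w   = suc (suc (suc zero))
pattern u'  = suc (suc (suc (suc zero)))
pattern u'' = suc (suc (suc (suc (suc zero))))
pattern x'  = suc (suc (suc (suc (suc (suc zero)))))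
pattern x'' = suc (suc (suc (suc (suc (suc (suc zero))))))
pattern w'  = suc (suc (suc (suc (suc (suc (suc (suc zero)))))))
pattern w'' = suc (suc (suc (suc (suc (suc (suc (suc (suc zero))))))))

isEdge : Fin 10 → Fin 10 → Bool
isEdge u' u = true
isEdge u u' = true
isEdge u x = true
isEdge x u = true
isEdge x x' = true
isEdge x' x = true
isEdge v w = true
isEdge w v = true
isEdge w w'' = true
isEdge w'' w = true
isEdge u'' u = true
isEdge u u'' = true
isEdge u v = true
isEdge v u = true
isEdge x'' x = true
isEdge x x'' = true
isEdge x w = true
isEdge w x = true
isEdge w w' = true
isEdge w' w = true
isEdge _ _ = false

H₀ : Graph
H₀ = record { V = Fin 10 ; Adj = λ a b → T (isEdge a b) }

Inc₀ : Set
Inc₀ = Incidence H₀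

σ₀ : (α₁' α₁ α₂ α₂' β₁ β₂ β₃ β₄ : ℕ) → PartialColouring H₀
σ₀ α₁' α₁ α₂ α₂' β₁ β₂ β₃ β₄ (u' , u , _) = just α₁'
σ₀ α₁' α₁ α₂ α₂' β₁ β₂ β₃ β₄ (u , u' , _) = just α₁
σ₀ α₁' α₁ α₂ α₂' β₁ β₂ β₃ β₄ (u , v , _) = just α₂
σ₀ α₁' α₁ α₂ α₂' β₁ β₂ β₃ β₄ (v , u , _) = just α₂'
σ₀ α₁' α₁ α₂ α₂' β₁ β₂ β₃ β₄ (w , v , _) = just β₁
σ₀ α₁' α₁ α₂ α₂' β₁ β₂ β₃ β₄ (w , w' , _) = just β₂
σ₀ α₁' α₁ α₂ α₂' β₁ β₂ β₃ β₄ (w , w'' , _) = just β₃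
σ₀ α₁' α₁ α₂ α₂' β₁ β₂ β₃ β₄ (w , x , _) = just β₄
σ₀ α₁' α₁ α₂ α₂' β₁ β₂ β₃ β₄ _ = nothing

extend : PartialColouring H₀ → (a b c d : ℕ) → PartialColouring H₀
extend σ a b c d (u , x , _) = just a
extend σ a b c d (u , u'' , _) = just b
extend σ a b c d (x , u , _) = just c
extend σ a b c d (x , w , _) = just d
extend σ a b c d i = σ i

i-u-ux : Inc₀
i-u-ux = u , x , _
i-u-uu'' : Inc₀
i-u-uu'' = u , u'' , _
i-x-xu : Inc₀
i-x-xu = x , u , _
i-x-xw : Inc₀
i-x-xw = x , w , _

module Submission where

-- Take a colour a for (u,ux) avoiding the four α's. If a cannot serve as b, colour
-- (x,xw), (x,xu), (u,uu'') greedily in this order, each avoiding what is already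
-- fixed; b ≠ a then holds for free. The case where a cannot serve as d is symmetric.
-- If a can serve as both, take b = d = a and recolour (u,ux) with a fresh a′; then c
-- still has only five colours to avoid. With lists of size 6 every greedy step has a
-- free colour. Properness of the extended colouring is then checked incidence by
-- incidence against the colours of the neighbours, which H₀ being finite lets us
-- compute by evaluation.

open import Defs
open import Data.Bool using (Bool; T)
open import Data.Bool.Properties using (T-irrelevant)
open import Data.Fin using (Fin) renaming (_≟_ to _≟ᶠ_)
open import Data.List using (List; []; _∷_; [_]; length; filter; concatMap; mapMaybe; allFin)
open import Data.List.Membership.Propositional using (_∈_; _∉_)
open import Data.List.Membership.Propositional.Properties using (∈-concatMap⁺; ∈-allFin; ∈-filter⁺)
open import Data.List.Properties using (filter-notAll)
open import Data.List.Relation.Unary.All using (All; _∷_; [])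
import Data.List.Relation.Unary.All as All
open import Data.List.Relation.Unary.Any using (here; there)
import Data.List.Relation.Unary.Any as Any
open import Data.List.Relation.Unary.Any.Properties using (map⁺; mapMaybe⁺)
open import Data.List.Relation.Unary.AllPairs using (_∷_)
open import Data.List.Relation.Unary.Unique.Propositional using (Unique)
open import Data.Maybe using (just)
import Data.Maybe.Relation.Unary.Any as Maybe
open import Data.Nat using (ℕ; _+_; _≤_; _<_)
open import Data.Nat.Properties using (<-≤-trans; ≤-pred; <⇒≤) renaming (_≟_ to _≟ℕ_)
open import Data.List.Membership.DecPropositional _≟ℕ_ using (_∈?_)
open import Data.Product using (Σ-syntax; ∃-syntax; _×_; _,_; proj₁; proj₂)
open import Data.Sum using (_⊎_; inj₁; inj₂)
open import Function using (_∘_)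
open import Relation.Binary.Definitions using (DecidableEquality)
open import Relation.Binary.PropositionalEquality using (_≡_; _≢_; refl; sym; trans; cong; subst)
open import Relation.Nullary using (Dec; yes; no; ¬?; contradiction)
open import Relation.Nullary.Decidable using (T?; _×-dec_; _⊎-dec_)

fresh : {xs : List ℕ} (fs : List ℕ) → Unique xs → length fs < length xs →
  ∃[ y ] y ∈ xs × y ∉ fs
fresh {y ∷ ys} fs (y∉ys ∷ ys-unique) fs<xs with y ∈? fs
... | no y∉fs = y , here refl , y∉fs
... | yes y∈fs
  with fresh (filter (λ z → ¬? (z ≟ℕ y)) fs) ys-unique
         (<-≤-trans (filter-notAll _ fs (Any.map (λ { refl y≢y → y≢y refl }) y∈fs)) (≤-pred fs<xs))
...   | z , z∈ys , z∉ =
  z , there z∈ys , λ z∈fs → z∉ (∈-filter⁺ _ z∈fs (λ { refl → All.lookup y∉ys z∈ys refl }))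

-- The required distinctions among a, b, c, d form a diamond: K₄ minus the edge bd.
record DiamondChoice (A B C D FA FB FC FD : List ℕ) : Set where
  field
    a b c d : ℕ
    a∈A : a ∈ A
    a∉FA : a ∉ FA
    b∈B : b ∈ B
    b∉FB : b ∉ FB
    c∈C : c ∈ C
    c∉FC : c ∉ FC
    d∈D : d ∈ D
    d∉FD : d ∉ FD
    a≢b : a ≢ b
    a≢c : a ≢ c
    a≢d : a ≢ d
    b≢c : b ≢ c
    c≢d : c ≢ d

Admissible : List ℕ → List ℕ → ℕ → Set
Admissible X FX y = y ∈ X × y ∉ FX

admissible? : (X FX : List ℕ) (y : ℕ) → Dec (Admissible X FX y)
admissible? X FX y = (y ∈? X) ×-dec ¬? (y ∈? FX)

module _ {A B C D : List ℕ} (FA FB FC FD : List ℕ)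
  (A-unique : Unique A) (B-unique : Unique B) (C-unique : Unique C) (D-unique : Unique D)
  (A-large : 2 + length FA ≤ length A) (B-large : 2 + length FB ≤ length B)
  (C-large : 3 + length FC ≤ length C) (D-large : 2 + length FD ≤ length D) where

  diamondChoice : DiamondChoice A B C D FA FB FC FD
  diamondChoice with fresh FA A-unique (<⇒≤ A-large)
  ... | a , a∈A , a∉FA with admissible? B FB a | admissible? D FD a
  ...   | no a-not-b | _ =
          let d , d∈D , d∉ = fresh (a ∷ FD) D-unique D-large
              c , c∈C , c∉ = fresh (a ∷ d ∷ FC) C-unique C-large
              b , b∈B , b∉ = fresh (c ∷ FB) B-unique B-large
          in record { a = a ; b = b ; c = c ; d = d
                    ; a∈A = a∈A ; a∉FA = a∉FA ; b∈B = b∈B ; b∉FB = b∉ ∘ there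
                    ; c∈C = c∈C ; c∉FC = c∉ ∘ there ∘ there ; d∈D = d∈D ; d∉FD = d∉ ∘ there
                    ; a≢b = λ a≡b → a-not-b (subst (Admissible B FB) (sym a≡b) (b∈B , b∉ ∘ there))
                    ; a≢c = c∉ ∘ here ∘ sym
                    ; a≢d = d∉ ∘ here ∘ sym ; b≢c = b∉ ∘ here ; c≢d = c∉ ∘ there ∘ here }
  ...   | yes _ | no a-not-d =
          let b , b∈B , b∉ = fresh (a ∷ FB) B-unique B-large
              c , c∈C , c∉ = fresh (a ∷ b ∷ FC) C-unique C-large
              d , d∈D , d∉ = fresh (c ∷ FD) D-unique D-large
          in record { a = a ; b = b ; c = c ; d = d
                    ; a∈A = a∈A ; a∉FA = a∉FA ; b∈B = b∈B ; b∉FB = b∉ ∘ there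
                    ; c∈C = c∈C ; c∉FC = c∉ ∘ there ∘ there ; d∈D = d∈D ; d∉FD = d∉ ∘ there
                    ; a≢b = b∉ ∘ here ∘ sym ; a≢c = c∉ ∘ here ∘ sym
                    ; a≢d = λ a≡d → a-not-d (subst (Admissible D FD) (sym a≡d) (d∈D , d∉ ∘ there))
                    ; b≢c = c∉ ∘ there ∘ here ∘ sym
                    ; c≢d = d∉ ∘ here ∘ sym }
  ...   | yes (a∈B , a∉FB) | yes (a∈D , a∉FD) =
          let a′ , a′∈A , a′∉ = fresh (a ∷ FA) A-unique A-large
              c , c∈C , c∉ = fresh (a′ ∷ a ∷ FC) C-unique C-large
          in record { a = a′ ; b = a ; c = c ; d = a
                    ; a∈A = a′∈A ; a∉FA = a′∉ ∘ there ; b∈B = a∈B ; b∉FB = a∉FB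
                    ; c∈C = c∈C ; c∉FC = c∉ ∘ there ∘ there ; d∈D = a∈D ; d∉FD = a∉FD
                    ; a≢b = a′∉ ∘ here ; a≢c = c∉ ∘ here ∘ sym ; a≢d = a′∉ ∘ here
                    ; b≢c = c∉ ∘ there ∘ here ∘ sym ; c≢d = c∉ ∘ there ∘ here }

module _ (G : Graph) where
  open Graph G

  SameEdge-swapˡ : ∀ {p q r s} → SameEdge G p q r s → SameEdge G q p r s
  SameEdge-swapˡ (inj₁ (refl , refl)) = inj₂ (refl , refl)
  SameEdge-swapˡ (inj₂ (refl , refl)) = inj₁ (refl , refl)

  SameEdge-sym : ∀ {p q r s} → SameEdge G p q r s → SameEdge G r s p q
  SameEdge-sym (inj₁ (refl , refl)) = inj₁ (refl , refl)
  SameEdge-sym (inj₂ (refl , refl)) = inj₂ (refl , refl)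

  AdjacentInc-sym : ∀ {i j} → AdjacentInc G i j → AdjacentInc G j i
  AdjacentInc-sym (inj₁ refl) = inj₁ refl
  AdjacentInc-sym (inj₂ (inj₁ e)) = inj₂ (inj₁ (SameEdge-sym e))
  AdjacentInc-sym (inj₂ (inj₂ (inj₁ e))) = inj₂ (inj₂ (inj₂ (SameEdge-swapˡ e)))
  AdjacentInc-sym (inj₂ (inj₂ (inj₂ e))) = inj₂ (inj₂ (inj₁ (SameEdge-swapˡ e)))

  module _ (_≟_ : DecidableEquality V) where

    sameEdge? : ∀ p q r s → Dec (SameEdge G p q r s)
    sameEdge? p q r s = ((p ≟ r) ×-dec (q ≟ s)) ⊎-dec ((p ≟ s) ×-dec (q ≟ r))

    adjacentInc? : ∀ i j → Dec (AdjacentInc G i j)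
    adjacentInc? (p , q , _) (r , s , _) =
      (p ≟ r) ⊎-dec sameEdge? p q r s ⊎-dec sameEdge? p r p q ⊎-dec sameEdge? p r r s

module BoolGraph {n : ℕ} (edge : Fin n → Fin n → Bool) where

  graph : Graph
  graph = record { V = Fin n ; Adj = λ p q → T (edge p q) }

  incidencesAt : (p q : Fin n) → List (Incidence graph)
  incidencesAt p q with T? (edge p q)
  ... | yes e = [ p , q , e ]
  ... | no _ = []

  ∈-incidencesAt : ∀ {p q} (e : T (edge p q)) → (p , q , e) ∈ incidencesAt p q
  ∈-incidencesAt {p} {q} e with T? (edge p q)
  ... | yes e′ = here (cong (λ e → p , q , e) (T-irrelevant e e′))
  ... | no ¬e = contradiction e ¬e

  incidences : List (Incidence graph)
  incidences = concatMap (λ p → concatMap (incidencesAt p) (allFin n)) (allFin n)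

  ∈-incidences : ∀ i → i ∈ incidences
  ∈-incidences (p , q , e) =
    ∈-concatMap⁺ _ (Any.map (λ { refl → ∈-concatMap⁺ _ (Any.map (λ { refl → ∈-incidencesAt e })
                                                              (∈-allFin q)) })
                            (∈-allFin p))

  _≟ᵢ_ : DecidableEquality (Incidence graph)
  (p , q , e) ≟ᵢ (r , s , e′) with p ≟ᶠ r | q ≟ᶠ s
  ... | yes refl | yes refl = yes (cong (λ e → p , q , e) (T-irrelevant e e′))
  ... | no p≢r | _ = no λ { refl → p≢r refl }
  ... | _ | no q≢s = no λ { refl → q≢s refl }

module Extension (G : Graph) (incidences : List (Incidence G)) (∈-incidences : ∀ i → i ∈ incidences)
  (_≟_ : DecidableEquality (Incidence G)) (adjacent? : ∀ i j → Dec (AdjacentInc G i j)) where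

  neighbours : Incidence G → List (Incidence G)
  neighbours i = filter (λ j → ¬? (i ≟ j) ×-dec adjacent? i j) incidences

  neighbourColours : PartialColouring G → Incidence G → List ℕ
  neighbourColours τ i = mapMaybe τ (neighbours i)

  ∈-neighbourColours : ∀ {τ i j k} → i ≢ j → AdjacentInc G i j → τ j ≡ just k →
    k ∈ neighbourColours τ i
  ∈-neighbourColours {τ} {i} {j} {k} i≢j i~j τj≡k =
    mapMaybe⁺ τ (neighbours i)
      (map⁺ (Any.map (λ { refl → subst (Maybe.Any (k ≡_)) (sym τj≡k) (Maybe.just refl) })
                     (∈-filter⁺ _ (∈-incidences j) (i≢j , i~j))))

  ProperlyColouredAt : ListAssignment G → PartialColouring G → Incidence G → Set
  ProperlyColouredAt L τ i = ∀ {k} → τ i ≡ just k → k ∈ L i × All (k ≢_) (neighbourColours τ i)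

  extension-valid : ∀ {L σ τ} → IsPartialListIncidenceColouring G L σ →
    All (λ i → τ i ≡ σ i ⊎ ProperlyColouredAt L τ i) incidences →
    IsPartialListIncidenceColouring G L τ
  extension-valid {L} {σ} {τ} (σ-lists , σ-proper) kept-or-proper = τ-lists , τ-proper
    where
    status : ∀ i → τ i ≡ σ i ⊎ ProperlyColouredAt L τ i
    status i = All.lookup kept-or-proper (∈-incidences i)

    τ-lists : ∀ i k → τ i ≡ just k → k ∈ L i
    τ-lists i k τi with status i
    ... | inj₁ τi≡σi = σ-lists i k (trans (sym τi≡σi) τi)
    ... | inj₂ proper = proj₁ (proper τi)

    τ-proper : ∀ i j k k′ → i ≢ j → AdjacentInc G i j → τ i ≡ just k → τ j ≡ just k′ → k ≢ k′
    τ-proper i j k k′ i≢j i~j τi τj with status i | status j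
    ... | inj₂ proper | _ = All.lookup (proj₂ (proper τi)) (∈-neighbourColours i≢j i~j τj)
    ... | _ | inj₂ proper =
      All.lookup (proj₂ (proper τj))
                 (∈-neighbourColours (i≢j ∘ sym) (AdjacentInc-sym G {i} {j} i~j) τi) ∘ sym
    ... | inj₁ τi≡σi | inj₁ τj≡σj =
      σ-proper i j k k′ i≢j i~j (trans (sym τi≡σi) τi) (trans (sym τj≡σj) τj)

open BoolGraph isEdge using (incidences; ∈-incidences; _≟ᵢ_)
open Extension H₀ incidences ∈-incidences _≟ᵢ_ (adjacentInc? H₀ _≟ᶠ_)

module _ {L : ListAssignment H₀} {α₁' α₁ α₂ α₂' β₁ β₂ β₃ β₄ : ℕ} where

  extend-σ₀-valid :
    IsPartialListIncidenceColouring H₀ L (σ₀ α₁' α₁ α₂ α₂' β₁ β₂ β₃ β₄) →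
    (choice : DiamondChoice (L i-u-ux) (L i-u-uu'') (L i-x-xu) (L i-x-xw)
                (α₁ ∷ α₁' ∷ α₂ ∷ α₂' ∷ []) (α₁ ∷ α₁' ∷ α₂ ∷ α₂' ∷ [])
                (α₁ ∷ α₂ ∷ β₄ ∷ []) (β₁ ∷ β₂ ∷ β₃ ∷ β₄ ∷ [])) →
    let open DiamondChoice choice in
    IsPartialListIncidenceColouring H₀ L (extend (σ₀ α₁' α₁ α₂ α₂' β₁ β₂ β₃ β₄) a b c d)
  -- Entries follow `incidences`: ux, uv, uu', uu'', xu, xw, xx', xx'', vu, vw, wx, …;
  -- the neighbour colours of (u,ux) evaluate to α₂ α₁ b c d α₂' α₁', of (u,uu'') to
  -- a α₂ α₁ c α₂' α₁', of (x,xu) to a α₂ α₁ b d β₄, and of (x,xw) to a c β₄ β₁ β₂ β₃.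
  extend-σ₀-valid σ₀-valid choice = extension-valid σ₀-valid
    ( inj₂ u-ux-proper ∷ inj₁ refl ∷ inj₁ refl ∷ inj₂ u-uu''-proper
    ∷ inj₂ x-xu-proper ∷ inj₂ x-xw-proper ∷ inj₁ refl ∷ inj₁ refl ∷ inj₁ refl ∷ inj₁ refl
    ∷ inj₁ refl ∷ inj₁ refl ∷ inj₁ refl ∷ inj₁ refl ∷ inj₁ refl ∷ inj₁ refl ∷ inj₁ refl
    ∷ inj₁ refl ∷ inj₁ refl ∷ inj₁ refl ∷ [])
    where
    open DiamondChoice choice
    τ : PartialColouring H₀
    τ = extend (σ₀ α₁' α₁ α₂ α₂' β₁ β₂ β₃ β₄) a b c d

    u-ux-proper : ProperlyColouredAt L τ i-u-ux
    u-ux-proper refl = a∈A , a∉FA ∘ there ∘ there ∘ here ∷ a∉FA ∘ here ∷ a≢b ∷ a≢c ∷ a≢d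
                           ∷ a∉FA ∘ there ∘ there ∘ there ∘ here ∷ a∉FA ∘ there ∘ here ∷ []

    u-uu''-proper : ProperlyColouredAt L τ i-u-uu''
    u-uu''-proper refl = b∈B , a≢b ∘ sym ∷ b∉FB ∘ there ∘ there ∘ here ∷ b∉FB ∘ here ∷ b≢c
                               ∷ b∉FB ∘ there ∘ there ∘ there ∘ here ∷ b∉FB ∘ there ∘ here ∷ []

    x-xu-proper : ProperlyColouredAt L τ i-x-xu
    x-xu-proper refl = c∈C , a≢c ∘ sym ∷ c∉FC ∘ there ∘ here ∷ c∉FC ∘ here ∷ b≢c ∘ sym ∷ c≢d
                             ∷ c∉FC ∘ there ∘ there ∘ here ∷ []

    x-xw-proper : ProperlyColouredAt L τ i-x-xw
    x-xw-proper refl = d∈D , a≢d ∘ sym ∷ c≢d ∘ sym ∷ d∉FD ∘ there ∘ there ∘ there ∘ here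
                             ∷ d∉FD ∘ here ∷ d∉FD ∘ there ∘ here ∷ d∉FD ∘ there ∘ there ∘ here ∷ []

lemma8 : (L₀ : ListAssignment H₀) → IsListAssignment H₀ L₀ →
    ((i : Inc₀) → 6 ≤ length (L₀ i)) →
    (α₁' α₁ α₂ α₂' β₁ β₂ β₃ β₄ : ℕ) →
    IsPartialListIncidenceColouring H₀ L₀ (σ₀ α₁' α₁ α₂ α₂' β₁ β₂ β₃ β₄) →
    Σ[ a ∈ ℕ ] Σ[ b ∈ ℕ ] Σ[ c ∈ ℕ ] Σ[ d ∈ ℕ ]
      ((a ∈ L₀ i-u-ux × a ≢ α₁ × a ≢ α₁' × a ≢ α₂ × a ≢ α₂') ×
       (b ∈ L₀ i-u-uu'' × b ≢ α₁ × b ≢ α₁' × b ≢ α₂ × b ≢ α₂') ×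
       (c ∈ L₀ i-x-xu × c ≢ α₁ × c ≢ α₂ × c ≢ β₄) ×
       (d ∈ L₀ i-x-xw × d ≢ β₁ × d ≢ β₂ × d ≢ β₃ × d ≢ β₄) ×
       (a ≢ b × a ≢ c × b ≢ c) ×
       (a ≢ c × a ≢ d × c ≢ d) ×
       IsPartialListIncidenceColouring H₀ L₀
         (extend (σ₀ α₁' α₁ α₂ α₂' β₁ β₂ β₃ β₄) a b c d))
lemma8 L unique large α₁' α₁ α₂ α₂' β₁ β₂ β₃ β₄ σ₀-valid =
  a , b , c , d
  , (a∈A , a∉FA ∘ here , a∉FA ∘ there ∘ here , a∉FA ∘ there ∘ there ∘ here
         , a∉FA ∘ there ∘ there ∘ there ∘ here)
  , (b∈B , b∉FB ∘ here , b∉FB ∘ there ∘ here , b∉FB ∘ there ∘ there ∘ here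
         , b∉FB ∘ there ∘ there ∘ there ∘ here)
  , (c∈C , c∉FC ∘ here , c∉FC ∘ there ∘ here , c∉FC ∘ there ∘ there ∘ here)
  , (d∈D , d∉FD ∘ here , d∉FD ∘ there ∘ here , d∉FD ∘ there ∘ there ∘ here
         , d∉FD ∘ there ∘ there ∘ there ∘ here)
  , (a≢b , a≢c , b≢c) , (a≢c , a≢d , c≢d)
  , extend-σ₀-valid σ₀-valid choice
  where
  choice : DiamondChoice (L i-u-ux) (L i-u-uu'') (L i-x-xu) (L i-x-xw)
             (α₁ ∷ α₁' ∷ α₂ ∷ α₂' ∷ []) (α₁ ∷ α₁' ∷ α₂ ∷ α₂' ∷ [])
             (α₁ ∷ α₂ ∷ β₄ ∷ []) (β₁ ∷ β₂ ∷ β₃ ∷ β₄ ∷ [])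
  choice = diamondChoice _ _ _ _
    (unique i-u-ux) (unique i-u-uu'') (unique i-x-xu) (unique i-x-xw)
    (large i-u-ux) (large i-u-uu'') (large i-x-xu) (large i-x-xw)
  open DiamondChoice choice
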